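{- Let $M$ and $N$ be realizable matroids of rank three on $[d]$. If $V_N\subseteq V_M$, then $N\geq M$.
   Context: For a rank-three matroid $K$ on $[d]$, $\Gamma_K\subseteq\mathbb{C}^{3\times d}$ is the set of collections of $d$ vectors in $\mathbb{C}^3$ whose linearly dependent subcollections are exactly those indexed by dependent sets of $K$; $K$ is realizable if $\Gamma_K\neq\emptyset$; $V_K$ is the Zariski closure of $\Gamma_K$. Dependency order: $N\geq M$ iff every dependent set of $M$ is dependent in $N$. -}

module Defs where

open import Level using (Level; _⊔_) renaming (suc to lsuc)
open import Data.Nat as ℕ using (ℕ; zero; suc)
open import Data.Fin using (Fin)
open import Data.Fin.Subset using (Subset; _∈_; _∉_; _⊆_; ∣_∣; ⁅_⁆; _∪_) renaming (⊥ to ∅)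
open import Data.Product using (Σ; ∃; ∃-syntax; _×_; _,_)
open import Data.List using (List; []; _∷_)
open import Relation.Nullary using (¬_)
open import Algebra.Bundles using (CommutativeRing)

-- Fields (the paper works over ℂ)

record IsField {c ℓ} (R : CommutativeRing c ℓ) : Set (c ⊔ ℓ) where
  open CommutativeRing R
  field
    0≉1     : ¬ (0# ≈ 1#)
    inverse : ∀ x → ¬ (x ≈ 0#) → ∃[ y ] (x * y ≈ 1#)

module _ {c ℓ} (R : CommutativeRing c ℓ) where
  open CommutativeRing R

  ofℕ : ℕ → Carrier
  ofℕ zero    = 0#
  ofℕ (suc n) = 1# + ofℕ n

  CharZero : Set ℓ
  CharZero = ∀ n → ¬ (ofℕ (suc n) ≈ 0#)

  -- univariate polynomials as coefficient lists a₀ ∷ a₁ ∷ … (lowest first)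
  evalU : List Carrier → Carrier → Carrier
  evalU []       x = 0#
  evalU (a ∷ as) x = a + x * evalU as x

  -- every monic polynomial x^(n+1) + a_n x^n + … + a_0 has a root
  AlgClosed : Set (c ⊔ ℓ)
  AlgClosed = ∀ (as : List Carrier) →
    ∃[ x ] (evalU as x + x * powU x as ≈ 0#)
    where
    powU : Carrier → List Carrier → Carrier
    powU x []       = 1#
    powU x (_ ∷ as) = x * powU x as

record Matroid (d : ℕ) : Set₁ where
  field
    Indep      : Subset d → Set
    indep-∅    : Indep ∅
    indep-⊆    : ∀ {A B} → A ⊆ B → Indep B → Indep A
    indep-aug  : ∀ {A B} → Indep A → Indep B → ∣ A ∣ ℕ.< ∣ B ∣ →
                 ∃[ x ] (x ∈ B × x ∉ A × Indep (A ∪ ⁅ x ⁆))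

  Dependent : Subset d → Set
  Dependent S = ¬ Indep S

HasRank : ∀ {d} → ℕ → Matroid d → Set
HasRank r M = (∃[ B ] (Indep B × ∣ B ∣ ≡ r)) × (∀ B → Indep B → ∣ B ∣ ℕ.≤ r)
  where open Matroid M
        open import Relation.Binary.PropositionalEquality using (_≡_)

_≥ᴹ_ : ∀ {d} → Matroid d → Matroid d → Set
N ≥ᴹ M = ∀ S → Matroid.Dependent M S → Matroid.Dependent N S

module Config {c ℓ} (R : CommutativeRing c ℓ) where
  open CommutativeRing R

  sumF : ∀ {n} → (Fin n → Carrier) → Carrier
  sumF {zero}  f = 0#
  sumF {suc n} f = f Fin.zero + sumF (λ i → f (Fin.suc i))
    where import Data.Fin as Fin

  -- a collection of d vectors in K³ : a 3 × d matrix, column j = j-th vector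
  Mat : ℕ → Set c
  Mat d = Fin 3 → Fin d → Carrier

  LinDep : ∀ {d} → Mat d → Subset d → Set (c ⊔ ℓ)
  LinDep {d} A S = Σ (Fin d → Carrier) λ λ′ →
      ((∀ j → j ∉ S → λ′ j ≈ 0#)
     × (∃[ j ] (j ∈ S × ¬ (λ′ j ≈ 0#)))
     × (∀ i → sumF (λ j → λ′ j * A i j) ≈ 0#))

  Γ : ∀ {d} → Matroid d → Mat d → Set (c ⊔ ℓ)
  Γ K A = ∀ S → (LinDep A S → Matroid.Dependent K S)
              × (Matroid.Dependent K S → LinDep A S)

  Realizable : ∀ {d} → Matroid d → Set (c ⊔ ℓ)
  Realizable {d} K = ∃[ A ] Γ K A

  data Poly (X : Set) : Set c where
    con  : Carrier → Poly X
    var  : X → Poly X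
    _⊕_  : Poly X → Poly X → Poly X
    _⊗_  : Poly X → Poly X → Poly X

  eval : ∀ {X} → Poly X → (X → Carrier) → Carrier
  eval (con a)  x = a
  eval (var v)  x = x v
  eval (p ⊕ q)  x = eval p x + eval q x
  eval (p ⊗ q)  x = eval p x * eval q x

  Coord : ℕ → Set
  Coord d = Fin 3 × Fin d

  evalM : ∀ {d} → Poly (Coord d) → Mat d → Carrier
  evalM p A = eval p (λ { (i , j) → A i j })

  V : ∀ {d} → Matroid d → Mat d → Set (c ⊔ ℓ)
  V {d} K A = ∀ (p : Poly (Coord d)) →
    (∀ B → Γ K B → evalM p B ≈ 0#) → evalM p A ≈ 0#

{-# OPTIONS --safe #-}
module Submission where

-- Suppose S is dependent in M but independent in N, and let A realise N.  Then A
-- lies in V_N ⊆ V_M, and |S| ≤ 3 because N has rank three.  For |S| ≤ 3 the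
-- matrices whose columns indexed by S are dependent form a Zariski-closed set, cut
-- out by those columns themselves, by their cross product, or by their determinant.
-- This set contains Γ_M, hence V_M, hence A; so S is dependent for A, i.e. in N.
-- Conversely vanishing of these minors yields explicit dependencies, from
-- (x·v) u − (x·u) v = x × (u × v) and the adjugate identity
-- (x·(v×w)) u + (x·(w×u)) v + (x·(u×v)) w = det(u,v,w) x, with x a basis vector
-- chosen to make one coefficient non-zero.  As equality in R need not be decidable
-- this choice is made under double negation, which suffices since the conclusion
-- is a negation.

open import Defs
open import Level using (Level; _⊔_; 0ℓ)
open import Algebra.Bundles using (CommutativeRing; RawRing)
open import Algebra.Solver.Ring.AlmostCommutativeRing
  using (_-Raw-AlmostCommutative⟶_; fromCommutativeRing)
open import Data.Bool using (true; false)
open import Data.Empty using (⊥-elim)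
open import Data.Fin using (Fin; zero; suc)
open import Data.Fin.Subset using (Subset; _∈_; _∉_; ∣_∣)
open import Data.Fin.Subset.Properties using (drop-there)
open import Data.Maybe using (Maybe; just; nothing)
open import Data.Nat as ℕ using (ℕ; zero; suc; s≤s)
open import Data.Product using (∃-syntax; _×_; _,_; proj₁; proj₂; swap)
open import Data.Product.Properties using (≡-dec)
open import Data.Sum using (_⊎_; inj₁; inj₂; [_,_])
open import Data.Vec using (Vec; []; _∷_; map; tabulate; here; there)
open import Data.Vec.N-ary using (N-ary)
open import Data.Vec.Properties using (map-∘)
open import Data.Vec.Relation.Unary.Any using (Any; here; there)
import Data.Vec.Relation.Unary.Any.Properties as Any
open import Function using (_∘_)
open import Relation.Binary.PropositionalEquality as ≡ using (_≡_)
open import Relation.Nullary using (¬_; yes; no)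
open import Relation.Nullary.Decidable.Core using (¬¬-excluded-middle)
open import Relation.Nullary.Negation using (¬¬-map)
open import Relation.Unary using (Pred)

module IntegerCoefficients {c ℓ} (R : CommutativeRing c ℓ) where
  open CommutativeRing R
  open import Algebra.Properties.Ring ring
    using (-0#≈0#; -‿+-comm; ⁻¹-anti-homo‿-; -‿distribˡ-*; -‿distribʳ-*; x[y-z]≈xy-xz)
  open import Algebra.Properties.Semiring.Mult.TCOptimised semiring
    using (×-homo-+; ×1-homo-*) renaming (_×_ to _×′_)
  open import Algebra.Properties.CommutativeSemigroup +-commutativeSemigroup
    using (interchange)
  open import Relation.Binary.Reasoning.Setoid setoid

  -- (m , n) stands for the integer m − n.
  ℤ₂ : Set
  ℤ₂ = ℕ × ℕ

  _+ᶻ_ : ℤ₂ → ℤ₂ → ℤ₂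
  (m , n) +ᶻ (m′ , n′) = m ℕ.+ m′ , n ℕ.+ n′

  _*ᶻ_ : ℤ₂ → ℤ₂ → ℤ₂
  (m , n) *ᶻ (m′ , n′) = m ℕ.* m′ ℕ.+ n ℕ.* n′ , m ℕ.* n′ ℕ.+ n ℕ.* m′

  ℤ₂-rawRing : RawRing 0ℓ 0ℓ
  ℤ₂-rawRing = record
    { Carrier = ℤ₂
    ; _≈_     = _≡_
    ; _+_     = _+ᶻ_
    ; _*_     = _*ᶻ_
    ; -_      = swap
    ; 0#      = 0 , 0
    ; 1#      = 1 , 0
    }

  difference : ℤ₂ → Carrier
  difference (m , n) = m ×′ 1# - n ×′ 1#

  -- Common successors are cancelled first, so that ⟦ 0 , 0 ⟧ and ⟦ 1 , 0 ⟧ are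
  -- 0# and 1# on the nose: the constants of R may then occur in solver goals.
  ⟦_⟧ : ℤ₂ → Carrier
  ⟦ m     , zero  ⟧ = m ×′ 1#
  ⟦ zero  , suc n ⟧ = - (suc n ×′ 1#)
  ⟦ suc m , suc n ⟧ = ⟦ m , n ⟧

  difference-homo-+ : ∀ p q → difference (p +ᶻ q) ≈ difference p + difference q
  difference-homo-+ (m , n) (m′ , n′) = begin
    (m ℕ.+ m′) ×′ 1# - (n ℕ.+ n′) ×′ 1#  ≈⟨ +-cong (×-homo-+ 1# m m′) (-‿cong (×-homo-+ 1# n n′)) ⟩
    (M + M′) - (N + N′)                  ≈⟨ +-congˡ (-‿+-comm N N′) ⟨
    (M + M′) + (- N + - N′)              ≈⟨ interchange M M′ (- N) (- N′) ⟩
    (M - N) + (M′ - N′)                  ∎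
    where
    M M′ N N′ : Carrier
    M = m ×′ 1#; M′ = m′ ×′ 1#; N = n ×′ 1#; N′ = n′ ×′ 1#

  difference-scale : ∀ m m′ n′ → difference (m ℕ.* m′ , m ℕ.* n′) ≈ m ×′ 1# * difference (m′ , n′)
  difference-scale m m′ n′ = begin
    (m ℕ.* m′) ×′ 1# - (m ℕ.* n′) ×′ 1#  ≈⟨ +-cong (×1-homo-* m m′) (-‿cong (×1-homo-* m n′)) ⟩
    M * M′ - M * N′                      ≈⟨ x[y-z]≈xy-xz M M′ N′ ⟨
    M * (M′ - N′)                        ∎
    where
    M M′ N′ : Carrier
    M = m ×′ 1#; M′ = m′ ×′ 1#; N′ = n′ ×′ 1#

  difference-homo-* : ∀ p q → difference (p *ᶻ q) ≈ difference p * difference q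
  difference-homo-* (m , n) (m′ , n′) = begin
    difference ((m ℕ.* m′ , m ℕ.* n′) +ᶻ (n ℕ.* n′ , n ℕ.* m′))
      ≈⟨ difference-homo-+ (m ℕ.* m′ , m ℕ.* n′) (n ℕ.* n′ , n ℕ.* m′) ⟩
    difference (m ℕ.* m′ , m ℕ.* n′) + difference (n ℕ.* n′ , n ℕ.* m′)
      ≈⟨ +-cong (difference-scale m m′ n′) (difference-scale n n′ m′) ⟩
    M * D + N * (N′ - M′)  ≈⟨ +-congˡ (*-congˡ (⁻¹-anti-homo‿- M′ N′)) ⟨
    M * D + N * - D        ≈⟨ +-congˡ (-‿distribʳ-* N D) ⟨
    M * D + - (N * D)      ≈⟨ +-congˡ (-‿distribˡ-* N D) ⟩
    M * D + - N * D        ≈⟨ distribʳ D M (- N) ⟨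
    (M - N) * D            ∎
    where
    M N M′ N′ D : Carrier
    M = m ×′ 1#; N = n ×′ 1#; M′ = m′ ×′ 1#; N′ = n′ ×′ 1#; D = M′ - N′

  difference-swap : ∀ p → difference (swap p) ≈ - difference p
  difference-swap (m , n) = sym (⁻¹-anti-homo‿- (m ×′ 1#) (n ×′ 1#))

  difference-suc : ∀ m n → difference (suc m , suc n) ≈ difference (m , n)
  difference-suc m n = begin
    difference ((1 , 1) +ᶻ (m , n))  ≈⟨ difference-homo-+ (1 , 1) (m , n) ⟩
    (1# - 1#) + difference (m , n)   ≈⟨ +-congʳ (-‿inverseʳ 1#) ⟩
    0# + difference (m , n)          ≈⟨ +-identityˡ _ ⟩
    difference (m , n)               ∎

  ⟦⟧≈difference : ∀ p → ⟦ p ⟧ ≈ difference p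
  ⟦⟧≈difference (m     , zero)  = sym (trans (+-congˡ -0#≈0#) (+-identityʳ _))
  ⟦⟧≈difference (zero  , suc n) = sym (+-identityˡ _)
  ⟦⟧≈difference (suc m , suc n) = trans (⟦⟧≈difference (m , n)) (sym (difference-suc m n))

  morphism : ℤ₂-rawRing -Raw-AlmostCommutative⟶ fromCommutativeRing R
  morphism = record
    { ⟦_⟧    = ⟦_⟧
    ; +-homo = λ p q → via (p +ᶻ q) (difference-homo-+ p q) (+-cong (⟦⟧≈difference p) (⟦⟧≈difference q))
    ; *-homo = λ p q → via (p *ᶻ q) (difference-homo-* p q) (*-cong (⟦⟧≈difference p) (⟦⟧≈difference q))
    ; -‿homo = λ p → via (swap p) (difference-swap p) (-‿cong (⟦⟧≈difference p))
    ; 0-homo = refl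
    ; 1-homo = refl
    }
    where
    via : ∀ p {x y} → difference p ≈ x → y ≈ x → ⟦ p ⟧ ≈ y
    via p d≈x y≈x = trans (⟦⟧≈difference p) (trans d≈x (sym y≈x))

  decide : ∀ p q → Maybe (⟦ p ⟧ ≈ ⟦ q ⟧)
  decide (suc m , suc n) q               = decide (m , n) q
  decide p               (suc m , suc n) = decide p (m , n)
  decide p               q               with ≡-dec ℕ._≟_ ℕ._≟_ p q
  ... | yes ≡.refl = just refl
  ... | no _       = nothing

  open import Algebra.Solver.Ring ℤ₂-rawRing (fromCommutativeRing R) morphism decide public
    using (Polynomial; con; _:+_; _:*_; :-_; solve; _:=_)

  polynomials : ℕ → RawRing 0ℓ 0ℓ
  polynomials n = record
    { Carrier = Polynomial n
    ; _≈_     = _≡_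
    ; _+_     = _:+_
    ; _*_     = _:*_
    ; -_      = :-_
    ; 0#      = con (0 , 0)
    ; 1#      = con (1 , 0)
    }

pattern 𝟎 = zero
pattern 𝟏 = suc zero
pattern 𝟐 = suc (suc zero)

module Space₃ {c ℓ} (ℛ : RawRing c ℓ) where
  open RawRing ℛ

  V³ : Set c
  V³ = Fin 3 → Carrier

  vec : Carrier → Carrier → Carrier → V³
  vec x y z 𝟎 = x
  vec x y z 𝟏 = y
  vec x y z 𝟐 = z

  basis : Fin 3 → V³
  basis 𝟎 = vec 1# 0# 0#
  basis 𝟏 = vec 0# 1# 0#
  basis 𝟐 = vec 0# 0# 1#

  dot : ∀ {k} → Vec Carrier k → Vec Carrier k → Carrier
  dot []       []       = 0#
  dot (x ∷ xs) (y ∷ ys) = x * y + dot xs ys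

  combination : ∀ {k} → Vec Carrier k → Vec V³ k → V³
  combination cs vs r = dot cs (map (λ v → v r) vs)

  infix 7 _·_
  _·_ : V³ → V³ → Carrier
  u · v = dot (tabulate u) (tabulate v)

  cross : V³ → V³ → V³
  cross u v 𝟎 = u 𝟏 * v 𝟐 + - (u 𝟐 * v 𝟏)
  cross u v 𝟏 = u 𝟐 * v 𝟎 + - (u 𝟎 * v 𝟐)
  cross u v 𝟐 = u 𝟎 * v 𝟏 + - (u 𝟏 * v 𝟎)

  det : V³ → V³ → V³ → Carrier
  det u v w = u · cross v w

module Identities {c ℓ} (R : CommutativeRing c ℓ) where
  open CommutativeRing R
  open import Algebra.Properties.Ring ring using (-0#≈0#)
  open IntegerCoefficients R
  open Space₃ rawRing
  private module Sym {n} = Space₃ (polynomials n)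

  private
    *-zeroʳ-≈ : ∀ x {y} → y ≈ 0# → x * y ≈ 0#
    *-zeroʳ-≈ x y≈0 = trans (*-congˡ y≈0) (zeroʳ x)

    +-zero-≈ : ∀ {x y} → x ≈ 0# → y ≈ 0# → x + y ≈ 0#
    +-zero-≈ x≈0 y≈0 = trans (+-cong x≈0 y≈0) (+-identityʳ 0#)

    -‿zero-≈ : ∀ {x} → x ≈ 0# → - x ≈ 0#
    -‿zero-≈ x≈0 = trans (-‿cong x≈0) -0#≈0#

  ·-zeroˡ : ∀ {u} v → (∀ i → u i ≈ 0#) → u · v ≈ 0#
  ·-zeroˡ {u} v u≈0 = +-zero-≈ (uᵢvᵢ≈0 𝟎) (+-zero-≈ (uᵢvᵢ≈0 𝟏) (+-zero-≈ (uᵢvᵢ≈0 𝟐) refl))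
    where
    uᵢvᵢ≈0 : ∀ i → u i * v i ≈ 0#
    uᵢvᵢ≈0 i = trans (*-congʳ (u≈0 i)) (zeroˡ (v i))

  cross-zeroʳ : ∀ u {v} → (∀ i → v i ≈ 0#) → ∀ m → cross u v m ≈ 0#
  cross-zeroʳ u v≈0 𝟎 = +-zero-≈ (*-zeroʳ-≈ (u 𝟏) (v≈0 𝟐)) (-‿zero-≈ (*-zeroʳ-≈ (u 𝟐) (v≈0 𝟏)))
  cross-zeroʳ u v≈0 𝟏 = +-zero-≈ (*-zeroʳ-≈ (u 𝟐) (v≈0 𝟎)) (-‿zero-≈ (*-zeroʳ-≈ (u 𝟎) (v≈0 𝟐)))
  cross-zeroʳ u v≈0 𝟐 = +-zero-≈ (*-zeroʳ-≈ (u 𝟎) (v≈0 𝟏)) (-‿zero-≈ (*-zeroʳ-≈ (u 𝟏) (v≈0 𝟎)))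

  ·-basisˡ : ∀ i v → basis i · v ≈ v i
  ·-basisˡ 𝟎 v = solve 3 (λ v₀ v₁ v₂ → Sym.basis 𝟎 Sym.· Sym.vec v₀ v₁ v₂ := v₀) refl (v 𝟎) (v 𝟏) (v 𝟐)
  ·-basisˡ 𝟏 v = solve 3 (λ v₀ v₁ v₂ → Sym.basis 𝟏 Sym.· Sym.vec v₀ v₁ v₂ := v₁) refl (v 𝟎) (v 𝟏) (v 𝟐)
  ·-basisˡ 𝟐 v = solve 3 (λ v₀ v₁ v₂ → Sym.basis 𝟐 Sym.· Sym.vec v₀ v₁ v₂ := v₂) refl (v 𝟎) (v 𝟏) (v 𝟐)

  module _ (c₁ c₂ c₃ : Carrier) (u v w : V³) where
    private
      s : V³
      s = combination (c₁ ∷ c₂ ∷ c₃ ∷ []) (u ∷ v ∷ w ∷ [])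

    det-combination₁ : c₁ * det u v w ≈ s · cross v w
    det-combination₁ = solve 12 (λ c₁ c₂ c₃ u₀ u₁ u₂ v₀ v₁ v₂ w₀ w₁ w₂ →
      let u = Sym.vec u₀ u₁ u₂; v = Sym.vec v₀ v₁ v₂; w = Sym.vec w₀ w₁ w₂ in
      c₁ :* Sym.det u v w := Sym.combination (c₁ ∷ c₂ ∷ c₃ ∷ []) (u ∷ v ∷ w ∷ []) Sym.· Sym.cross v w)
      refl c₁ c₂ c₃ (u 𝟎) (u 𝟏) (u 𝟐) (v 𝟎) (v 𝟏) (v 𝟐) (w 𝟎) (w 𝟏) (w 𝟐)

    det-combination₂ : c₂ * det u v w ≈ s · cross w u
    det-combination₂ = solve 12 (λ c₁ c₂ c₃ u₀ u₁ u₂ v₀ v₁ v₂ w₀ w₁ w₂ →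
      let u = Sym.vec u₀ u₁ u₂; v = Sym.vec v₀ v₁ v₂; w = Sym.vec w₀ w₁ w₂ in
      c₂ :* Sym.det u v w := Sym.combination (c₁ ∷ c₂ ∷ c₃ ∷ []) (u ∷ v ∷ w ∷ []) Sym.· Sym.cross w u)
      refl c₁ c₂ c₃ (u 𝟎) (u 𝟏) (u 𝟐) (v 𝟎) (v 𝟏) (v 𝟐) (w 𝟎) (w 𝟏) (w 𝟐)

    det-combination₃ : c₃ * det u v w ≈ s · cross u v
    det-combination₃ = solve 12 (λ c₁ c₂ c₃ u₀ u₁ u₂ v₀ v₁ v₂ w₀ w₁ w₂ →
      let u = Sym.vec u₀ u₁ u₂; v = Sym.vec v₀ v₁ v₂; w = Sym.vec w₀ w₁ w₂ in
      c₃ :* Sym.det u v w := Sym.combination (c₁ ∷ c₂ ∷ c₃ ∷ []) (u ∷ v ∷ w ∷ []) Sym.· Sym.cross u v)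
      refl c₁ c₂ c₃ (u 𝟎) (u 𝟏) (u 𝟐) (v 𝟎) (v 𝟏) (v 𝟐) (w 𝟎) (w 𝟏) (w 𝟐)

  private
    cross-cross-statement : Fin 3 → N-ary 9 (Polynomial 9) (Polynomial 9 × Polynomial 9)
    cross-cross-statement r x₀ x₁ x₂ u₀ u₁ u₂ v₀ v₁ v₂ =
      let x = Sym.vec x₀ x₁ x₂; u = Sym.vec u₀ u₁ u₂; v = Sym.vec v₀ v₁ v₂ in
      Sym.combination (x Sym.· v ∷ :- (x Sym.· u) ∷ []) (u ∷ v ∷ []) r := Sym.cross x (Sym.cross u v) r

    adjugate-statement : Fin 3 → N-ary 12 (Polynomial 12) (Polynomial 12 × Polynomial 12)
    adjugate-statement r x₀ x₁ x₂ u₀ u₁ u₂ v₀ v₁ v₂ w₀ w₁ w₂ =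
      let x = Sym.vec x₀ x₁ x₂; u = Sym.vec u₀ u₁ u₂; v = Sym.vec v₀ v₁ v₂; w = Sym.vec w₀ w₁ w₂ in
      Sym.combination (x Sym.· Sym.cross v w ∷ x Sym.· Sym.cross w u ∷ x Sym.· Sym.cross u v ∷ [])
                      (u ∷ v ∷ w ∷ []) r
        := Sym.det u v w :* x r

  combination-cross-cross : ∀ x u v r →
    combination (x · v ∷ - (x · u) ∷ []) (u ∷ v ∷ []) r ≈ cross x (cross u v) r
  combination-cross-cross x u v 𝟎 =
    solve 9 (cross-cross-statement 𝟎) refl (x 𝟎) (x 𝟏) (x 𝟐) (u 𝟎) (u 𝟏) (u 𝟐) (v 𝟎) (v 𝟏) (v 𝟐)
  combination-cross-cross x u v 𝟏 =
    solve 9 (cross-cross-statement 𝟏) refl (x 𝟎) (x 𝟏) (x 𝟐) (u 𝟎) (u 𝟏) (u 𝟐) (v 𝟎) (v 𝟏) (v 𝟐)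
  combination-cross-cross x u v 𝟐 =
    solve 9 (cross-cross-statement 𝟐) refl (x 𝟎) (x 𝟏) (x 𝟐) (u 𝟎) (u 𝟏) (u 𝟐) (v 𝟎) (v 𝟏) (v 𝟐)

  combination-adjugate : ∀ x u v w r →
    combination (x · cross v w ∷ x · cross w u ∷ x · cross u v ∷ []) (u ∷ v ∷ w ∷ []) r ≈ det u v w * x r
  combination-adjugate x u v w 𝟎 = solve 12 (adjugate-statement 𝟎) refl
    (x 𝟎) (x 𝟏) (x 𝟐) (u 𝟎) (u 𝟏) (u 𝟐) (v 𝟎) (v 𝟏) (v 𝟐) (w 𝟎) (w 𝟏) (w 𝟐)
  combination-adjugate x u v w 𝟏 = solve 12 (adjugate-statement 𝟏) refl
    (x 𝟎) (x 𝟏) (x 𝟐) (u 𝟎) (u 𝟏) (u 𝟐) (v 𝟎) (v 𝟏) (v 𝟐) (w 𝟎) (w 𝟏) (w 𝟐)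
  combination-adjugate x u v w 𝟐 = solve 12 (adjugate-statement 𝟐) refl
    (x 𝟎) (x 𝟏) (x 𝟐) (u 𝟎) (u 𝟏) (u 𝟐) (v 𝟎) (v 𝟏) (v 𝟐) (w 𝟎) (w 𝟏) (w 𝟐)

elements : ∀ {d} (S : Subset d) → Vec (Fin d) ∣ S ∣
elements []          = []
elements (true ∷ S)  = zero ∷ map suc (elements S)
elements (false ∷ S) = map suc (elements S)

Any-elements⁺ : ∀ {d p} {P : Pred (Fin d) p} {S j} → j ∈ S → P j → Any P (elements S)
Any-elements⁺ {S = true ∷ S}  here        Pj = here Pj
Any-elements⁺ {S = true ∷ S}  (there j∈S) Pj = there (Any.map⁺ (Any-elements⁺ j∈S Pj))
Any-elements⁺ {S = false ∷ S} (there j∈S) Pj = Any.map⁺ (Any-elements⁺ j∈S Pj)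

Any-elements⁻ : ∀ {d p} {P : Pred (Fin d) p} (S : Subset d) → Any P (elements S) → ∃[ j ] (j ∈ S × P j)
Any-elements⁻ (true ∷ S)  (here Pj) = zero , here , Pj
Any-elements⁻ (true ∷ S)  (there P∈S) with Any-elements⁻ S (Any.map⁻ P∈S)
... | j , j∈S , Pj = suc j , there j∈S , Pj
Any-elements⁻ (false ∷ S) P∈S with Any-elements⁻ S (Any.map⁻ P∈S)
... | j , j∈S , Pj = suc j , there j∈S , Pj

¬¬-all-or-counterexample : ∀ {n p} (P : Fin n → Set p) → ¬ ¬ ((∀ i → P i) ⊎ ∃[ i ] ¬ P i)
¬¬-all-or-counterexample {zero}  P k = k (inj₁ λ ())
¬¬-all-or-counterexample {suc n} P k = ¬¬-excluded-middle λ where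
  (no ¬P₀) → k (inj₂ (zero , ¬P₀))
  (yes P₀) → ¬¬-all-or-counterexample (P ∘ suc) λ where
    (inj₁ P₊)        → k (inj₁ λ where zero → P₀; (suc i) → P₊ i)
    (inj₂ (i , ¬Pᵢ)) → k (inj₂ (suc i , ¬Pᵢ))

module LinearDependence {c ℓ} (R : CommutativeRing c ℓ) where
  open CommutativeRing R hiding (zero)
  open Space₃ rawRing

  Dependent : ∀ {k} → Vec V³ k → Set (c ⊔ ℓ)
  Dependent vs = ∃[ cs ] (Any (_≉ 0#) cs × (∀ r → combination cs vs r ≈ 0#))

  dependent-∷ : ∀ {k} v {vs : Vec V³ k} → Dependent vs → Dependent (v ∷ vs)
  dependent-∷ v (cs , cs≉0 , cs·vs≈0) =
    0# ∷ cs , there cs≉0 , λ r → trans (+-congʳ (zeroˡ (v r))) (trans (+-identityˡ _) (cs·vs≈0 r))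

module Columns {c ℓ} (R : CommutativeRing c ℓ) where
  open CommutativeRing R hiding (zero)
  open Config R
  open Space₃ rawRing
  open LinearDependence R
  open import Relation.Binary.Reasoning.Setoid setoid

  col : ∀ {d} → Mat d → Fin d → V³
  col A j i = A i j

  cols : ∀ {d k} → Mat d → Vec (Fin d) k → Vec V³ k
  cols A = map (col A)

  combination-cols : ∀ {d k} cs (A : Mat d) (es : Vec (Fin d) k) r →
                     combination cs (cols A es) r ≡ dot cs (map (A r) es)
  combination-cols cs A es r = ≡.cong (dot cs) (≡.sym (map-∘ (λ v → v r) (col A) es))

  spread : ∀ {d} (S : Subset d) → Vec Carrier ∣ S ∣ → Fin d → Carrier
  spread (true ∷ S)  (x ∷ xs) zero    = x
  spread (true ∷ S)  (x ∷ xs) (suc j) = spread S xs j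
  spread (false ∷ S) xs       zero    = 0#
  spread (false ∷ S) xs       (suc j) = spread S xs j

  spread-∉ : ∀ {d} (S : Subset d) cs {j} → j ∉ S → spread S cs j ≈ 0#
  spread-∉ (true ∷ S)  (x ∷ xs) {zero}  j∉S = ⊥-elim (j∉S here)
  spread-∉ (true ∷ S)  (x ∷ xs) {suc j} j∉S = spread-∉ S xs (j∉S ∘ there)
  spread-∉ (false ∷ S) xs       {zero}  _   = refl
  spread-∉ (false ∷ S) xs       {suc j} j∉S = spread-∉ S xs (j∉S ∘ there)

  map-spread : ∀ {d} (S : Subset d) cs → map (spread S cs) (elements S) ≡ cs
  map-spread []          []       = ≡.refl
  map-spread (true ∷ S)  (x ∷ xs) =
    ≡.cong (x ∷_) (≡.trans (≡.sym (map-∘ _ suc (elements S))) (map-spread S xs))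
  map-spread (false ∷ S) xs       = ≡.trans (≡.sym (map-∘ _ suc (elements S))) (map-spread S xs)

  sumF-elements : ∀ {d} (S : Subset d) (f g : Fin d → Carrier) → (∀ j → j ∉ S → f j ≈ 0#) →
                  sumF (λ j → f j * g j) ≈ dot (map f (elements S)) (map g (elements S))
  sumF-elements-suc : ∀ {d b} (S : Subset d) (f g : Fin (suc d) → Carrier) →
                      (∀ j → j ∉ b ∷ S → f j ≈ 0#) →
                      sumF (λ j → f (suc j) * g (suc j)) ≈
                      dot (map f (map suc (elements S))) (map g (map suc (elements S)))

  sumF-elements []          f g _   = refl
  sumF-elements (true ∷ S)  f g f≈0 = +-congˡ (sumF-elements-suc S f g f≈0)
  sumF-elements (false ∷ S) f g f≈0 = begin
    f zero * g zero + sumF (λ j → f (suc j) * g (suc j))  ≈⟨ +-congʳ (*-congʳ (f≈0 zero λ ())) ⟩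
    0# * g zero + sumF (λ j → f (suc j) * g (suc j))      ≈⟨ +-congʳ (zeroˡ (g zero)) ⟩
    0# + sumF (λ j → f (suc j) * g (suc j))               ≈⟨ +-identityˡ _ ⟩
    sumF (λ j → f (suc j) * g (suc j))                    ≈⟨ sumF-elements-suc S f g f≈0 ⟩
    dot (map f (map suc (elements S))) (map g (map suc (elements S))) ∎

  sumF-elements-suc S f g f≈0 = begin
    sumF (λ j → f (suc j) * g (suc j))
      ≈⟨ sumF-elements S (f ∘ suc) (g ∘ suc) (λ j j∉S → f≈0 (suc j) (j∉S ∘ drop-there)) ⟩
    dot (map (f ∘ suc) (elements S)) (map (g ∘ suc) (elements S))
      ≡⟨ ≡.cong₂ dot (map-∘ f suc (elements S)) (map-∘ g suc (elements S)) ⟩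
    dot (map f (map suc (elements S))) (map g (map suc (elements S))) ∎

  LinDep⇒Dependent : ∀ {d} {A : Mat d} {S} → LinDep A S → Dependent (cols A (elements S))
  LinDep⇒Dependent {A = A} {S} (λ′ , λ′≈0 , (j , j∈S , λ′j≉0) , λ′A≈0) =
    map λ′ es , Any.map⁺ (Any-elements⁺ j∈S λ′j≉0) , λ r → begin
      combination (map λ′ es) (cols A es) r  ≡⟨ combination-cols (map λ′ es) A es r ⟩
      dot (map λ′ es) (map (A r) es)         ≈⟨ sumF-elements S λ′ (A r) λ′≈0 ⟨
      sumF (λ j → λ′ j * A r j)              ≈⟨ λ′A≈0 r ⟩
      0#                                     ∎
    where
    es : Vec (Fin _) ∣ S ∣
    es = elements S

  Dependent⇒LinDep : ∀ {d} {A : Mat d} {S} → Dependent (cols A (elements S)) → LinDep A S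
  Dependent⇒LinDep {A = A} {S} (cs , cs≉0 , cs·A≈0) =
    spread S cs , (λ _ → spread-∉ S cs) , nonzero , λ r → begin
      sumF (λ j → spread S cs j * A r j)
        ≈⟨ sumF-elements S (spread S cs) (A r) (λ _ → spread-∉ S cs) ⟩
      dot (map (spread S cs) es) (map (A r) es)
        ≡⟨ ≡.cong (λ cs′ → dot cs′ (map (A r) es)) (map-spread S cs) ⟩
      dot cs (map (A r) es)                      ≡⟨ combination-cols cs A es r ⟨
      combination cs (cols A es) r               ≈⟨ cs·A≈0 r ⟩
      0#                                         ∎
    where
    es : Vec (Fin _) ∣ S ∣
    es = elements S

    nonzero : ∃[ j ] (j ∈ S × spread S cs j ≉ 0#)
    nonzero = Any-elements⁻ S (Any.map⁻ (≡.subst (Any (_≉ 0#)) (≡.sym (map-spread S cs)) cs≉0))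

module SmallFamilies {c ℓ} (R : CommutativeRing c ℓ) (F : IsField R) where
  open CommutativeRing R hiding (zero)
  open IsField F
  open Space₃ rawRing
  open Identities R
  open LinearDependence R
  open import Relation.Binary.Reasoning.Setoid setoid

  x*y≈0⇒y≈0 : ∀ {x y} → x ≉ 0# → x * y ≈ 0# → y ≈ 0#
  x*y≈0⇒y≈0 {x} {y} x≉0 xy≈0 with inverse x x≉0
  ... | x⁻¹ , xx⁻¹≈1 = begin
    y                ≈⟨ *-identityˡ y ⟨
    1# * y           ≈⟨ *-congʳ (trans (*-comm x⁻¹ x) xx⁻¹≈1) ⟨
    (x⁻¹ * x) * y    ≈⟨ *-assoc x⁻¹ x y ⟩
    x⁻¹ * (x * y)    ≈⟨ *-congˡ xy≈0 ⟩
    x⁻¹ * 0#         ≈⟨ zeroʳ x⁻¹ ⟩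
    0#               ∎

  dependent⇒≈0 : ∀ {v} → Dependent (v ∷ []) → ∀ r → v r ≈ 0#
  dependent⇒≈0 (a ∷ [] , here a≉0 , av≈0) r = x*y≈0⇒y≈0 a≉0 (trans (sym (+-identityʳ _)) (av≈0 r))

  ≈0⇒dependent : ∀ {v} → (∀ r → v r ≈ 0#) → Dependent (v ∷ [])
  ≈0⇒dependent {v} v≈0 =
    1# ∷ [] , here (0≉1 ∘ sym) , λ r → trans (+-identityʳ _) (trans (*-identityˡ (v r)) (v≈0 r))

  dependent⇒det≈0 : ∀ {u v w} → Dependent (u ∷ v ∷ w ∷ []) → det u v w ≈ 0#
  dependent⇒det≈0 {u} {v} {w} (c₁ ∷ c₂ ∷ c₃ ∷ [] , here c₁≉0 , s≈0) =
    x*y≈0⇒y≈0 c₁≉0 (trans (det-combination₁ c₁ c₂ c₃ u v w) (·-zeroˡ (cross v w) s≈0))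
  dependent⇒det≈0 {u} {v} {w} (c₁ ∷ c₂ ∷ c₃ ∷ [] , there (here c₂≉0) , s≈0) =
    x*y≈0⇒y≈0 c₂≉0 (trans (det-combination₂ c₁ c₂ c₃ u v w) (·-zeroˡ (cross w u) s≈0))
  dependent⇒det≈0 {u} {v} {w} (c₁ ∷ c₂ ∷ c₃ ∷ [] , there (there (here c₃≉0)) , s≈0) =
    x*y≈0⇒y≈0 c₃≉0 (trans (det-combination₃ c₁ c₂ c₃ u v w) (·-zeroˡ (cross u v) s≈0))

  -- cross u v m = det (basis m) u v
  dependent⇒cross≈0 : ∀ {u v} → Dependent (u ∷ v ∷ []) → ∀ m → cross u v m ≈ 0#
  dependent⇒cross≈0 {u} {v} dep m =
    trans (sym (·-basisˡ m (cross u v))) (dependent⇒det≈0 (dependent-∷ (basis m) dep))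

  cross≈0⇒¬¬dependent : ∀ {u v} → (∀ m → cross u v m ≈ 0#) → ¬ ¬ Dependent (u ∷ v ∷ [])
  cross≈0⇒¬¬dependent {u} {v} u×v≈0 =
    ¬¬-map [ dependent-∷ u ∘ ≈0⇒dependent , nonzero-case ] (¬¬-all-or-counterexample (λ i → v i ≈ 0#))
    where
    nonzero-case : ∃[ i ] ¬ (v i ≈ 0#) → Dependent (u ∷ v ∷ [])
    nonzero-case (i , vᵢ≉0) =
      basis i · v ∷ - (basis i · u) ∷ [] ,
      here (vᵢ≉0 ∘ trans (sym (·-basisˡ i v))) ,
      λ r → trans (combination-cross-cross (basis i) u v r) (cross-zeroʳ (basis i) u×v≈0 r)

  det≈0⇒¬¬dependent : ∀ {u v w} → det u v w ≈ 0# → ¬ ¬ Dependent (u ∷ v ∷ w ∷ [])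
  det≈0⇒¬¬dependent {u} {v} {w} det≈0 ¬dep =
    ¬¬-all-or-counterexample (λ m → cross v w m ≈ 0#) λ where
      (inj₁ v×w≈0)        → cross≈0⇒¬¬dependent v×w≈0 (¬dep ∘ dependent-∷ u)
      (inj₂ (m , v×wₘ≉0)) → ¬dep (nonzero-case m v×wₘ≉0)
    where
    nonzero-case : ∀ m → ¬ (cross v w m ≈ 0#) → Dependent (u ∷ v ∷ w ∷ [])
    nonzero-case m v×wₘ≉0 =
      x · cross v w ∷ x · cross w u ∷ x · cross u v ∷ [] ,
      here (v×wₘ≉0 ∘ trans (sym (·-basisˡ m (cross v w)))) ,
      λ r → trans (combination-adjugate x u v w r) (trans (*-congʳ det≈0) (zeroˡ (x r)))
      where
      x : V³
      x = basis m

module ZariskiClosure {c ℓ} (R : CommutativeRing c ℓ) where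
  open CommutativeRing R hiding (zero)
  open Config R

  -- V K is Closure (Γ K) by definition.
  Closure : ∀ {d} → (Mat d → Set (c ⊔ ℓ)) → Mat d → Set (c ⊔ ℓ)
  Closure {d} P A = ∀ (p : Poly (Coord d)) → (∀ B → P B → evalM p B ≈ 0#) → evalM p A ≈ 0#

  module _ {d} {P : Mat d → Set (c ⊔ ℓ)} where

    ⊆-closure : ∀ {A} → P A → Closure P A
    ⊆-closure PA p p≈0 = p≈0 _ PA

    closure-mono : ∀ {Q} → (∀ B → P B → Q B) → ∀ {A} → Closure P A → Closure Q A
    closure-mono P⊆Q A∈P̄ p p≈0 = A∈P̄ p λ B PB → p≈0 B (P⊆Q B PB)

    vanishes-on-closure : ∀ (p : Poly (Coord d)) {f : Mat d → Carrier} → (∀ B → evalM p B ≈ f B) →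
                          (∀ B → P B → f B ≈ 0#) → ∀ {A} → Closure P A → f A ≈ 0#
    vanishes-on-closure p p≈f f≈0 {A} A∈P̄ =
      trans (sym (p≈f A)) (A∈P̄ p λ B PB → trans (p≈f B) (f≈0 B PB))

module DeterminantalLoci {c ℓ} (R : CommutativeRing c ℓ) (F : IsField R) where
  open CommutativeRing R hiding (zero)
  open import Algebra.Properties.Ring ring using (-1*x≈-x)
  open IsField F
  open Config R
  open Space₃ rawRing
  open LinearDependence R
  open Columns R
  open SmallFamilies R F
  open ZariskiClosure R

  coordinatePolynomials : ℕ → RawRing c c
  coordinatePolynomials d = record
    { Carrier = Poly (Coord d)
    ; _≈_     = _≡_
    ; _+_     = _⊕_
    ; _*_     = _⊗_
    ; -_      = con (- 1#) ⊗_
    ; 0#      = con 0#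
    ; 1#      = con 1#
    }

  private module P {d} = Space₃ (coordinatePolynomials d)

  column : ∀ {d} → Fin d → P.V³
  column j i = var (i , j)

  evalM-cross : ∀ {d} (s t : Fin d) m A →
                evalM (P.cross (column s) (column t) m) A ≈ cross (col A s) (col A t) m
  evalM-cross s t 𝟎 A = +-congˡ (-1*x≈-x _)
  evalM-cross s t 𝟏 A = +-congˡ (-1*x≈-x _)
  evalM-cross s t 𝟐 A = +-congˡ (-1*x≈-x _)

  evalM-det : ∀ {d} (s t u : Fin d) A →
              evalM (P.det (column s) (column t) (column u)) A ≈ det (col A s) (col A t) (col A u)
  evalM-det s t u A = +-cong (*-congˡ (evalM-cross t u 𝟎 A))
                     (+-cong (*-congˡ (evalM-cross t u 𝟏 A))
                     (+-cong (*-congˡ (evalM-cross t u 𝟐 A)) refl))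

  closure-dependent⇒¬¬dependent : ∀ {d k} (es : Vec (Fin d) k) → k ℕ.≤ 3 → ∀ {A} →
    Closure (λ B → Dependent (cols B es)) A → ¬ ¬ Dependent (cols A es)
  closure-dependent⇒¬¬dependent [] _ A∈P̄ _ = 0≉1 (sym (A∈P̄ (con 1#) λ _ → λ ()))
  closure-dependent⇒¬¬dependent (s ∷ []) _ A∈P̄ ¬dep =
    ¬dep (≈0⇒dependent λ r → A∈P̄ (var (r , s)) λ _ dep → dependent⇒≈0 dep r)
  closure-dependent⇒¬¬dependent (s ∷ t ∷ []) _ A∈P̄ = cross≈0⇒¬¬dependent λ m →
    vanishes-on-closure (P.cross (column s) (column t) m) (evalM-cross s t m)
                        (λ _ dep → dependent⇒cross≈0 dep m) A∈P̄
  closure-dependent⇒¬¬dependent (s ∷ t ∷ u ∷ []) _ A∈P̄ = det≈0⇒¬¬dependent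
    (vanishes-on-closure (P.det (column s) (column t) (column u)) (evalM-det s t u)
                         (λ _ → dependent⇒det≈0) A∈P̄)
  closure-dependent⇒¬¬dependent (_ ∷ _ ∷ _ ∷ _ ∷ _) (s≤s (s≤s (s≤s ())))

lemma7p2 : ∀ {c ℓ : Level} (R : CommutativeRing c ℓ) → IsField R → CharZero R → AlgClosed R →
    ∀ (d : ℕ) (M N : Matroid d) → HasRank 3 M → HasRank 3 N →
    Config.Realizable R M → Config.Realizable R N →
    (∀ A → Config.V R N A → Config.V R M A) →
    N ≥ᴹ M
lemma7p2 R F _ _ _ _ _ _ rankN _ (A , A∈ΓN) VN⊆VM S M-dependent N-independent =
  closure-dependent⇒¬¬dependent (elements S) (proj₂ rankN S N-independent) A∈closure
    λ dependent → proj₁ (A∈ΓN S) (Dependent⇒LinDep dependent) N-independent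
  where
  open LinearDependence R
  open Columns R
  open ZariskiClosure R
  open DeterminantalLoci R F

  A∈closure : Closure (λ B → Dependent (cols B (elements S))) A
  A∈closure = closure-mono (λ B B∈ΓM → LinDep⇒Dependent (proj₂ (B∈ΓM S) M-dependent))
                           (VN⊆VM A (⊆-closure A∈ΓN))
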